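{- Let $v>k>i\ge 0$ be integers with $v\ge 2k$ and $(v,k,i)\neq(2k,k,0)$, let $X=J(v,k,i)$ and $\Delta=v-2k+2i$. Let $A,B$ be vertices of $X$ with $x=|A\cap B|<i$. Then $$\mathrm{dist}(A,B)=\begin{cases} 3 & \text{if } x<k-\Delta;\\ \left\lceil \frac{k-x}{k-i}\right\rceil & \text{if } x\ge k-\Delta.\end{cases}$$
   Context: For integers $v>k>i\ge 0$, the generalized Johnson graph $J(v,k,i)$ is the simple undirected graph whose vertices are the $k$-element subsets of a fixed $v$-element set, two vertices $A,B$ being adjacent iff $|A\cap B|=i$. $\mathrm{dist}$ denotes the graph distance. -}

module Defs where

open import Data.Nat using (ℕ; zero; suc; _+_; _*_; _∸_; _<_; _/_)
open import Data.Fin.Subset using (Subset; _∩_; ∣_∣)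
open import Data.Product using (Σ; _×_)
open import Relation.Binary.PropositionalEquality using (_≡_)
open import Relation.Nullary using (¬_)

Vertex : ℕ → ℕ → Set
Vertex v k = Σ (Subset v) (λ A → ∣ A ∣ ≡ k)

-- Adjacency in J(v,k,i): |A ∩ B| = i (simple graph: distinct vertices
-- automatically since |A ∩ A| = k ≠ i when i < k).
Adj : (v k i : ℕ) → Subset v → Subset v → Set
Adj v k i A B = ∣ A ∩ B ∣ ≡ i

data Walk (v k i : ℕ) : Subset v → Subset v → ℕ → Set where
  here : ∀ {A} → Walk v k i A A zero
  step : ∀ {A B C n} → ∣ B ∣ ≡ k → Adj v k i A B → Walk v k i B C n →
         Walk v k i A C (suc n)

Dist : (v k i : ℕ) → Subset v → Subset v → ℕ → Set
Dist v k i A B d = Walk v k i A B d × (∀ m → m < d → ¬ Walk v k i A B m)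

-- Ceiling division ⌈a / b⌉ for b > 0 (value at b = 0 irrelevant).
ceilDiv : ℕ → ℕ → ℕ
ceilDiv a zero = zero
ceilDiv a (suc b) = (a + b) / suc b

module Submission where

-- Fix the target B and measure a k-set C by y = |C ∩ B|; then |C ─ B| = k − y and
-- |∁ (C ∪ B)| = v − 2k + y.  Along an edge y grows by at most q = k − i (inclusion–exclusion),
-- so dist(A, B) ≥ ⌈(k − x)/q⌉; and a walk A − C − B forces k = |C| ≤ 2i + |∁ (A ∪ B)| = x + Δ.
-- Conversely, prescribing how many elements a neighbour D takes from each Venn region of C
-- and B, one can raise y by exactly q per step while |C ─ B| > 2q, and finish in two steps once
-- |C ─ B| ≤ 2q and k ≤ y + Δ.  When x + Δ < k, one such step first makes k ≤ y + Δ true.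

open import Defs
open import Data.Nat
open import Data.Nat.Properties
open import Data.Nat.DivMod using (m≡m%n+[m/n]*n; m%n<n; m<n*o⇒m/o<n)
open import Data.Nat.Tactic.RingSolver using (solve-∀)
open import Data.Product using (∃; _×_; _,_; proj₁; proj₂)
open import Data.Sum using (_⊎_; inj₁; inj₂; [_,_]′)
open import Data.Vec using (_∷_; [])
open import Data.Fin.Subset
open import Data.Fin.Subset.Properties
open import Relation.Binary.PropositionalEquality
open import Relation.Nullary using (¬_; yes; no)

private variable n : ℕ

∣p∣≡∣p∩q∣+∣p─q∣ : (p q : Subset n) → ∣ p ∣ ≡ ∣ p ∩ q ∣ + ∣ p ─ q ∣
∣p∣≡∣p∩q∣+∣p─q∣ []            []            = refl
∣p∣≡∣p∩q∣+∣p─q∣ (inside  ∷ p) (inside  ∷ q) = cong suc (∣p∣≡∣p∩q∣+∣p─q∣ p q)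
∣p∣≡∣p∩q∣+∣p─q∣ (inside  ∷ p) (outside ∷ q) = trans (cong suc (∣p∣≡∣p∩q∣+∣p─q∣ p q)) (sym (+-suc _ _))
∣p∣≡∣p∩q∣+∣p─q∣ (outside ∷ p) (inside  ∷ q) = ∣p∣≡∣p∩q∣+∣p─q∣ p q
∣p∣≡∣p∩q∣+∣p─q∣ (outside ∷ p) (outside ∷ q) = ∣p∣≡∣p∩q∣+∣p─q∣ p q

∣p∪q∣+∣p∩q∣≡∣p∣+∣q∣ : (p q : Subset n) → ∣ p ∪ q ∣ + ∣ p ∩ q ∣ ≡ ∣ p ∣ + ∣ q ∣
∣p∪q∣+∣p∩q∣≡∣p∣+∣q∣ []            []            = refl
∣p∪q∣+∣p∩q∣≡∣p∣+∣q∣ (inside  ∷ p) (inside  ∷ q) =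
  cong suc (trans (+-suc _ _) (trans (cong suc (∣p∪q∣+∣p∩q∣≡∣p∣+∣q∣ p q)) (sym (+-suc _ _))))
∣p∪q∣+∣p∩q∣≡∣p∣+∣q∣ (inside  ∷ p) (outside ∷ q) = cong suc (∣p∪q∣+∣p∩q∣≡∣p∣+∣q∣ p q)
∣p∪q∣+∣p∩q∣≡∣p∣+∣q∣ (outside ∷ p) (inside  ∷ q) = trans (cong suc (∣p∪q∣+∣p∩q∣≡∣p∣+∣q∣ p q)) (sym (+-suc _ _))
∣p∪q∣+∣p∩q∣≡∣p∣+∣q∣ (outside ∷ p) (outside ∷ q) = ∣p∪q∣+∣p∩q∣≡∣p∣+∣q∣ p q

∣p∪q∣≤∣p∣+∣q∣ : (p q : Subset n) → ∣ p ∪ q ∣ ≤ ∣ p ∣ + ∣ q ∣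
∣p∪q∣≤∣p∣+∣q∣ p q = ≤-trans (m≤m+n ∣ p ∪ q ∣ ∣ p ∩ q ∣) (≤-reflexive (∣p∪q∣+∣p∩q∣≡∣p∣+∣q∣ p q))

∣p∩r∣+∣r∩q∣≤∣r∣+∣p∩q∣ : (p r q : Subset n) → ∣ p ∩ r ∣ + ∣ r ∩ q ∣ ≤ ∣ r ∣ + ∣ p ∩ q ∣
∣p∩r∣+∣r∩q∣≤∣r∣+∣p∩q∣ p r q = begin
  ∣ p ∩ r ∣ + ∣ r ∩ q ∣                         ≡⟨ ∣p∪q∣+∣p∩q∣≡∣p∣+∣q∣ (p ∩ r) (r ∩ q) ⟨
  ∣ (p ∩ r) ∪ (r ∩ q) ∣ + ∣ (p ∩ r) ∩ (r ∩ q) ∣ ≤⟨ +-mono-≤ (p⊆q⇒∣p∣≤∣q∣ ∪⊆r) (p⊆q⇒∣p∣≤∣q∣ ∩⊆p∩q) ⟩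
  ∣ r ∣ + ∣ p ∩ q ∣                             ∎
  where
  open ≤-Reasoning
  ∪⊆r : (p ∩ r) ∪ (r ∩ q) ⊆ r
  ∪⊆r x∈ with x∈p∪q⁻ (p ∩ r) (r ∩ q) x∈
  ... | inj₁ x∈p∩r = proj₂ (x∈p∩q⁻ p r x∈p∩r)
  ... | inj₂ x∈r∩q = proj₁ (x∈p∩q⁻ r q x∈r∩q)
  ∩⊆p∩q : (p ∩ r) ∩ (r ∩ q) ⊆ p ∩ q
  ∩⊆p∩q x∈ with x∈p∩q⁻ (p ∩ r) (r ∩ q) x∈
  ... | x∈p∩r , x∈r∩q = x∈p∩q⁺ (proj₁ (x∈p∩q⁻ p r x∈p∩r) , proj₂ (x∈p∩q⁻ r q x∈r∩q))

∣r∣≤∣p∩r∣+∣r∩q∣+∣∁[p∪q]∣ : (p r q : Subset n) → ∣ r ∣ ≤ ∣ p ∩ r ∣ + ∣ r ∩ q ∣ + ∣ ∁ (p ∪ q) ∣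
∣r∣≤∣p∩r∣+∣r∩q∣+∣∁[p∪q]∣ p r q = begin
  ∣ r ∣                                 ≤⟨ p⊆q⇒∣p∣≤∣q∣ r⊆ ⟩
  ∣ ((p ∩ r) ∪ (r ∩ q)) ∪ ∁ (p ∪ q) ∣   ≤⟨ ∣p∪q∣≤∣p∣+∣q∣ ((p ∩ r) ∪ (r ∩ q)) _ ⟩
  ∣ (p ∩ r) ∪ (r ∩ q) ∣ + ∣ ∁ (p ∪ q) ∣ ≤⟨ +-monoˡ-≤ _ (∣p∪q∣≤∣p∣+∣q∣ (p ∩ r) (r ∩ q)) ⟩
  ∣ p ∩ r ∣ + ∣ r ∩ q ∣ + ∣ ∁ (p ∪ q) ∣ ∎
  where
  open ≤-Reasoning
  r⊆ : r ⊆ ((p ∩ r) ∪ (r ∩ q)) ∪ ∁ (p ∪ q)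
  r⊆ {x} x∈r with x ∈? p | x ∈? q
  ... | yes x∈p | _       = x∈p∪q⁺ (inj₁ (x∈p∪q⁺ (inj₁ (x∈p∩q⁺ (x∈p , x∈r)))))
  ... | no  _   | yes x∈q = x∈p∪q⁺ (inj₁ (x∈p∪q⁺ (inj₂ (x∈p∩q⁺ (x∈r , x∈q)))))
  ... | no  x∉p | no  x∉q = x∈p∪q⁺ (inj₂ (x∉p⇒x∈∁p λ x∈p∪q → [ x∉p , x∉q ]′ (x∈p∪q⁻ p q x∈p∪q)))

subset-with-Venn-counts : (C B : Subset n) {a b c e : ℕ} →
  a ≤ ∣ C ∩ B ∣ → b ≤ ∣ C ─ B ∣ → c ≤ ∣ B ─ C ∣ → e ≤ ∣ ∁ (C ∪ B) ∣ →
  ∃ λ D → ∣ D ∣ ≡ a + b + c + e × ∣ C ∩ D ∣ ≡ a + b × ∣ D ∩ B ∣ ≡ a + c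
subset-with-Venn-counts [] [] z≤n z≤n z≤n z≤n = [] , refl , refl , refl
subset-with-Venn-counts (inside ∷ C) (inside ∷ B) z≤n b≤ c≤ e≤ =
  let D , ∣D∣ , ∣C∩D∣ , ∣D∩B∣ = subset-with-Venn-counts C B z≤n b≤ c≤ e≤
  in outside ∷ D , ∣D∣ , ∣C∩D∣ , ∣D∩B∣
subset-with-Venn-counts (inside ∷ C) (inside ∷ B) (s≤s a≤) b≤ c≤ e≤ =
  let D , ∣D∣ , ∣C∩D∣ , ∣D∩B∣ = subset-with-Venn-counts C B a≤ b≤ c≤ e≤
  in inside ∷ D , cong suc ∣D∣ , cong suc ∣C∩D∣ , cong suc ∣D∩B∣
subset-with-Venn-counts (inside ∷ C) (outside ∷ B) a≤ z≤n c≤ e≤ =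
  let D , ∣D∣ , ∣C∩D∣ , ∣D∩B∣ = subset-with-Venn-counts C B a≤ z≤n c≤ e≤
  in outside ∷ D , ∣D∣ , ∣C∩D∣ , ∣D∩B∣
subset-with-Venn-counts (inside ∷ C) (outside ∷ B) {a} {suc b} {c} {e} a≤ (s≤s b≤) c≤ e≤ =
  let D , ∣D∣ , ∣C∩D∣ , ∣D∩B∣ = subset-with-Venn-counts C B a≤ b≤ c≤ e≤
  in inside ∷ D , trans (cong suc ∣D∣) (cong (λ m → m + c + e) (sym (+-suc a b))) ,
                 trans (cong suc ∣C∩D∣) (sym (+-suc a b)) , ∣D∩B∣
subset-with-Venn-counts (outside ∷ C) (inside ∷ B) a≤ b≤ z≤n e≤ =
  let D , ∣D∣ , ∣C∩D∣ , ∣D∩B∣ = subset-with-Venn-counts C B a≤ b≤ z≤n e≤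
  in outside ∷ D , ∣D∣ , ∣C∩D∣ , ∣D∩B∣
subset-with-Venn-counts (outside ∷ C) (inside ∷ B) {a} {b} {suc c} {e} a≤ b≤ (s≤s c≤) e≤ =
  let D , ∣D∣ , ∣C∩D∣ , ∣D∩B∣ = subset-with-Venn-counts C B a≤ b≤ c≤ e≤
  in inside ∷ D , trans (cong suc ∣D∣) (cong (_+ e) (sym (+-suc (a + b) c))) ,
                 ∣C∩D∣ , trans (cong suc ∣D∩B∣) (sym (+-suc a c))
subset-with-Venn-counts (outside ∷ C) (outside ∷ B) a≤ b≤ c≤ z≤n =
  let D , ∣D∣ , ∣C∩D∣ , ∣D∩B∣ = subset-with-Venn-counts C B a≤ b≤ c≤ z≤n
  in outside ∷ D , ∣D∣ , ∣C∩D∣ , ∣D∩B∣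
subset-with-Venn-counts (outside ∷ C) (outside ∷ B) {a} {b} {c} {suc e} a≤ b≤ c≤ (s≤s e≤) =
  let D , ∣D∣ , ∣C∩D∣ , ∣D∩B∣ = subset-with-Venn-counts C B a≤ b≤ c≤ e≤
  in inside ∷ D , trans (cong suc ∣D∣) (sym (+-suc (a + b + c) e)) , ∣C∩D∣ , ∣D∩B∣

m+m≡2*m : ∀ m → m + m ≡ 2 * m
m+m≡2*m m = cong (m +_) (sym (+-identityʳ m))

m+n≡o+p∧m≤o⇒p≤n : ∀ {m n o p} → m + n ≡ o + p → m ≤ o → p ≤ n
m+n≡o+p∧m≤o⇒p≤n {m} {n} {o} {p} eq m≤o = +-cancelˡ-≤ o p n (begin
  o + p ≡⟨ eq ⟨
  m + n ≤⟨ +-monoˡ-≤ n m≤o ⟩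
  o + n ∎)
  where open ≤-Reasoning

m+n≡o+p∧m<o⇒p<n : ∀ {m n o p} → m + n ≡ o + p → m < o → p < n
m+n≡o+p∧m<o⇒p<n {o = o} {p} eq = m+n≡o+p∧m≤o⇒p≤n (trans (cong suc eq) (sym (+-suc o p)))

a≤ceilDiv*b : ∀ a {b} → 0 < b → a ≤ ceilDiv a b * b
a≤ceilDiv*b a {suc s} _ = +-cancelˡ-≤ s a _ (begin
  s + a                                       ≡⟨ +-comm s a ⟩
  a + s                                       ≡⟨ m≡m%n+[m/n]*n (a + s) (suc s) ⟩
  (a + s) % suc s + ceilDiv a (suc s) * suc s ≤⟨ +-monoˡ-≤ _ (≤-pred (m%n<n (a + s) (suc s))) ⟩
  s + ceilDiv a (suc s) * suc s               ∎)
  where open ≤-Reasoning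

ceilDiv-least : ∀ {a b} m → 0 < b → a ≤ m * b → ceilDiv a b ≤ m
ceilDiv-least {a} {suc s} m _ a≤m*b =
  ≤-pred (m<n*o⇒m/o<n {a + s} {suc m} (s≤s (≤-trans (≤-reflexive (+-comm a s)) (+-monoʳ-≤ s a≤m*b))))

m<ceilDiv⇒m*b<a : ∀ {a b m} → 0 < b → m < ceilDiv a b → m * b < a
m<ceilDiv⇒m*b<a {m = m} 0<b m<d = ≰⇒> (λ a≤m*b → <⇒≱ m<d (ceilDiv-least m 0<b a≤m*b))

m*b<a⇒m<ceilDiv : ∀ {a b m} → 0 < b → m * b < a → m < ceilDiv a b
m*b<a⇒m<ceilDiv {a} {b} 0<b m*b<a =
  ≰⇒> (λ d≤m → <⇒≱ m*b<a (≤-trans (a≤ceilDiv*b a 0<b) (*-monoˡ-≤ b d≤m)))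

module _ {v k i : ℕ} where

  edge-∩-growth : ∀ {B C D} → ∣ D ∣ ≡ k → Adj v k i C D → ∣ D ∩ B ∣ ≤ (k ∸ i) + ∣ C ∩ B ∣
  edge-∩-growth {B} {C} {D} ∣D∣≡k C~D = +-cancelˡ-≤ i _ _ (begin
    i + ∣ D ∩ B ∣           ≡⟨ cong (_+ ∣ D ∩ B ∣) C~D ⟨
    ∣ C ∩ D ∣ + ∣ D ∩ B ∣   ≤⟨ ∣p∩r∣+∣r∩q∣≤∣r∣+∣p∩q∣ C D B ⟩
    ∣ D ∣ + ∣ C ∩ B ∣       ≡⟨ cong (_+ ∣ C ∩ B ∣) ∣D∣≡k ⟩
    k + ∣ C ∩ B ∣           ≤⟨ +-monoˡ-≤ ∣ C ∩ B ∣ (m≤n+m∸n k i) ⟩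
    i + (k ∸ i) + ∣ C ∩ B ∣ ≡⟨ +-assoc i (k ∸ i) ∣ C ∩ B ∣ ⟩
    i + ((k ∸ i) + ∣ C ∩ B ∣) ∎)
    where open ≤-Reasoning

  walk-length-bound : ∀ {A B m} → ∣ B ∣ ≡ k → Walk v k i A B m → k ≤ ∣ A ∩ B ∣ + m * (k ∸ i)
  walk-length-bound {B = B} ∣B∣≡k here = ≤-reflexive (begin
    k             ≡⟨ ∣B∣≡k ⟨
    ∣ B ∣         ≡⟨ cong ∣_∣ (∩-idem B) ⟨
    ∣ B ∩ B ∣     ≡⟨ +-identityʳ ∣ B ∩ B ∣ ⟨
    ∣ B ∩ B ∣ + 0 ∎)
    where open ≡-Reasoning
  walk-length-bound {A} {B} {suc m} ∣B∣≡k (step {B = C} ∣C∣≡k A~C C⇝B) = begin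
    k                                     ≤⟨ walk-length-bound ∣B∣≡k C⇝B ⟩
    ∣ C ∩ B ∣ + m * (k ∸ i)               ≤⟨ +-monoˡ-≤ (m * (k ∸ i)) (edge-∩-growth {B} {A} {C} ∣C∣≡k A~C) ⟩
    (k ∸ i) + ∣ A ∩ B ∣ + m * (k ∸ i)     ≡⟨ rearrange (k ∸ i) ∣ A ∩ B ∣ (m * (k ∸ i)) ⟩
    ∣ A ∩ B ∣ + ((k ∸ i) + m * (k ∸ i))   ∎
    where
    open ≤-Reasoning
    rearrange : ∀ a b c → a + b + c ≡ b + (a + c)
    rearrange = solve-∀

  walk₂-bound : ∀ {A B} → Walk v k i A B 2 → k ≤ ∣ ∁ (A ∪ B) ∣ + 2 * i
  walk₂-bound {A} {B} (step {B = C} ∣C∣≡k A~C (step _ C~B here)) = begin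
    k                                     ≡⟨ ∣C∣≡k ⟨
    ∣ C ∣                                 ≤⟨ ∣r∣≤∣p∩r∣+∣r∩q∣+∣∁[p∪q]∣ A C B ⟩
    ∣ A ∩ C ∣ + ∣ C ∩ B ∣ + ∣ ∁ (A ∪ B) ∣ ≡⟨ cong₂ (λ a b → a + b + ∣ ∁ (A ∪ B) ∣) A~C C~B ⟩
    i + i + ∣ ∁ (A ∪ B) ∣                 ≡⟨ rearrange i ∣ ∁ (A ∪ B) ∣ ⟩
    ∣ ∁ (A ∪ B) ∣ + 2 * i                 ∎
    where
    open ≤-Reasoning
    rearrange : ∀ a b → a + a + b ≡ b + 2 * a
    rearrange = solve-∀

module Towards {v k i : ℕ} (i<k : i < k) (2k≤v : 2 * k ≤ v) (B : Subset v) (∣B∣≡k : ∣ B ∣ ≡ k) where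

  q : ℕ
  q = k ∸ i

  Δ : ℕ
  Δ = v ∸ 2 * k + 2 * i

  0<q : 0 < q
  0<q = m<n⇒0<n∸m i<k

  i+q≡k : i + q ≡ k
  i+q≡k = m+[n∸m]≡n (<⇒≤ i<k)

  module _ (C : Subset v) (∣C∣≡k : ∣ C ∣ ≡ k) where

    ∣C∩B∣+∣C─B∣≡i+q : ∣ C ∩ B ∣ + ∣ C ─ B ∣ ≡ i + q
    ∣C∩B∣+∣C─B∣≡i+q = trans (sym (∣p∣≡∣p∩q∣+∣p─q∣ C B)) (trans ∣C∣≡k (sym i+q≡k))

    ∣B─C∣≡∣C─B∣ : ∣ B ─ C ∣ ≡ ∣ C ─ B ∣
    ∣B─C∣≡∣C─B∣ = +-cancelˡ-≡ ∣ C ∩ B ∣ _ _ (begin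
      ∣ C ∩ B ∣ + ∣ B ─ C ∣ ≡⟨ cong (λ X → ∣ X ∣ + ∣ B ─ C ∣) (∩-comm C B) ⟩
      ∣ B ∩ C ∣ + ∣ B ─ C ∣ ≡⟨ ∣p∣≡∣p∩q∣+∣p─q∣ B C ⟨
      ∣ B ∣                 ≡⟨ trans ∣B∣≡k (sym ∣C∣≡k) ⟩
      ∣ C ∣                 ≡⟨ ∣p∣≡∣p∩q∣+∣p─q∣ C B ⟩
      ∣ C ∩ B ∣ + ∣ C ─ B ∣ ∎)
      where open ≡-Reasoning

    ∣∁[C∪B]∣≡v∸2k+∣C∩B∣ : ∣ ∁ (C ∪ B) ∣ ≡ v ∸ 2 * k + ∣ C ∩ B ∣
    ∣∁[C∪B]∣≡v∸2k+∣C∩B∣ = begin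
      ∣ ∁ (C ∪ B) ∣     ≡⟨ ∣∁p∣≡n∸∣p∣ (C ∪ B) ⟩
      v ∸ u             ≡⟨ cong (_∸ u) (m∸n+n≡m 2k≤v) ⟨
      w + 2 * k ∸ u     ≡⟨ cong (λ t → w + t ∸ u) u+y≡2k ⟨
      w + (u + y) ∸ u   ≡⟨ cong (_∸ u) (rearrange w u y) ⟩
      u + (w + y) ∸ u   ≡⟨ m+n∸m≡n u (w + y) ⟩
      w + y             ∎
      where
      open ≡-Reasoning
      u = ∣ C ∪ B ∣
      y = ∣ C ∩ B ∣
      w = v ∸ 2 * k
      rearrange : ∀ a b c → a + (b + c) ≡ b + (a + c)
      rearrange = solve-∀
      u+y≡2k : u + y ≡ 2 * k
      u+y≡2k = trans (∣p∪q∣+∣p∩q∣≡∣p∣+∣q∣ C B) (trans (cong₂ _+_ ∣C∣≡k ∣B∣≡k) (m+m≡2*m k))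

    step-towards : q ≤ ∣ C ─ B ∣ → ∃ λ D → ∣ D ∣ ≡ k × Adj v k i C D × ∣ D ∩ B ∣ ≡ ∣ C ∩ B ∣ + q
    step-towards q≤r =
      let D , ∣D∣≡ , ∣C∩D∣≡ , ∣D∩B∣≡ =
            subset-with-Venn-counts C B ≤-refl i∸y≤r (≤-trans q≤r (≤-reflexive (sym ∣B─C∣≡∣C─B∣))) z≤n
      in D , trans ∣D∣≡ ∣D∣≡k , trans ∣C∩D∣≡ (m+[n∸m]≡n y≤i) , ∣D∩B∣≡
      where
      y = ∣ C ∩ B ∣
      y≤i : y ≤ i
      y≤i = m+n≡o+p∧m≤o⇒p≤n (trans (+-comm q i) (trans (sym ∣C∩B∣+∣C─B∣≡i+q) (+-comm y _))) q≤r
      i∸y≤r : i ∸ y ≤ ∣ C ─ B ∣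
      i∸y≤r = m≤n+o⇒m∸n≤o i y (≤-trans (m≤m+n i q) (≤-reflexive (sym ∣C∩B∣+∣C─B∣≡i+q)))
      ∣D∣≡k : y + (i ∸ y) + q + 0 ≡ k
      ∣D∣≡k = trans (+-identityʳ _) (trans (cong (_+ q) (m+[n∸m]≡n y≤i)) i+q≡k)

    walk₂-via : (a c e : ℕ) → a + c ≡ i → c + e ≡ q →
      a ≤ ∣ C ∩ B ∣ → c ≤ ∣ C ─ B ∣ → e ≤ ∣ ∁ (C ∪ B) ∣ → Walk v k i C B 2
    walk₂-via a c e a+c≡i c+e≡q a≤ c≤ e≤ =
      let D , ∣D∣≡ , ∣C∩D∣≡ , ∣D∩B∣≡ =
            subset-with-Venn-counts C B a≤ c≤ (≤-trans c≤ (≤-reflexive (sym ∣B─C∣≡∣C─B∣))) e≤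
      in step (trans ∣D∣≡ ∣D∣≡k) (trans ∣C∩D∣≡ a+c≡i) (step ∣B∣≡k (trans ∣D∩B∣≡ a+c≡i) here)
      where
      regroup : ∀ a c e → a + c + c + e ≡ (a + c) + (c + e)
      regroup = solve-∀
      ∣D∣≡k : a + c + c + e ≡ k
      ∣D∣≡k = trans (regroup a c e) (trans (cong₂ _+_ a+c≡i c+e≡q) i+q≡k)

    -- The middle vertex takes c = min(i, q, |C ─ B|) elements from each of C ─ B and B ─ C.
    walk₂-towards : ∣ C ─ B ∣ ≤ 2 * q → k ≤ ∣ C ∩ B ∣ + Δ → Walk v k i C B 2
    walk₂-towards r≤2q k≤y+Δ = by-cases (≤-total i q) (≤-total i r) (≤-total q r)
      where
      y = ∣ C ∩ B ∣
      r = ∣ C ─ B ∣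
      w = v ∸ 2 * k
      i≤r+y : i ≤ r + y
      i≤r+y = ≤-trans (m≤m+n i q) (≤-reflexive (trans (sym ∣C∩B∣+∣C─B∣≡i+q) (+-comm y r)))
      q≤r+y : q ≤ r + y
      q≤r+y = ≤-trans (m≤n+m q i) (≤-reflexive (trans (sym ∣C∩B∣+∣C─B∣≡i+q) (+-comm y r)))
      via-r : r ≤ i → r ≤ q → Walk v k i C B 2
      via-r r≤i r≤q = walk₂-via (i ∸ r) r (q ∸ r) (m∸n+n≡m r≤i) (m+[n∸m]≡n r≤q)
        (m≤n+o⇒m∸n≤o i r i≤r+y) ≤-refl
        (≤-trans (m≤n+o⇒m∸n≤o q r (≤-trans q≤r+y (+-monoʳ-≤ r (m≤n+m y w))))
                 (≤-reflexive (sym (∣∁[C∪B]∣≡v∸2k+∣C∩B∣))))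
      via-i : i ≤ q → i ≤ r → Walk v k i C B 2
      via-i i≤q i≤r = walk₂-via 0 i (q ∸ i) refl (m+[n∸m]≡n i≤q) z≤n i≤r
        (≤-trans (m≤n+o⇒m∸n≤o q i q≤i+[w+y]) (≤-reflexive (sym ∣∁[C∪B]∣≡v∸2k+∣C∩B∣)))
        where
        rearrange : ∀ y w i → y + (w + 2 * i) ≡ i + (i + (w + y))
        rearrange = solve-∀
        q≤i+[w+y] : q ≤ i + (w + y)
        q≤i+[w+y] = +-cancelˡ-≤ i _ _ (begin
          i + q               ≡⟨ i+q≡k ⟩
          k                   ≤⟨ k≤y+Δ ⟩
          y + (w + 2 * i)     ≡⟨ rearrange y w i ⟩
          i + (i + (w + y))   ∎)
          where open ≤-Reasoning
      via-q : q ≤ i → q ≤ r → Walk v k i C B 2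
      via-q q≤i q≤r = walk₂-via (i ∸ q) q 0 (m∸n+n≡m q≤i) (+-identityʳ q)
        (m≤n+o⇒m∸n≤o i q i≤q+y) q≤r z≤n
        where
        rearrange : ∀ y q → y + 2 * q ≡ q + y + q
        rearrange = solve-∀
        i≤q+y : i ≤ q + y
        i≤q+y = +-cancelʳ-≤ q i (q + y) (begin
          i + q       ≡⟨ ∣C∩B∣+∣C─B∣≡i+q ⟨
          y + r       ≤⟨ +-monoʳ-≤ y r≤2q ⟩
          y + 2 * q   ≡⟨ rearrange y q ⟩
          q + y + q   ∎)
          where open ≤-Reasoning
      by-cases : i ≤ q ⊎ q ≤ i → i ≤ r ⊎ r ≤ i → q ≤ r ⊎ r ≤ q → Walk v k i C B 2
      by-cases (inj₁ i≤q) (inj₁ i≤r) _          = via-i i≤q i≤r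
      by-cases (inj₁ i≤q) (inj₂ r≤i) _          = via-r r≤i (≤-trans r≤i i≤q)
      by-cases (inj₂ q≤i) _          (inj₁ q≤r) = via-q q≤i q≤r
      by-cases (inj₂ q≤i) _          (inj₂ r≤q) = via-r (≤-trans r≤q q≤i) r≤q

  q+∣D─B∣≡∣C─B∣ : ∀ C D → ∣ C ∣ ≡ k → ∣ D ∣ ≡ k → ∣ D ∩ B ∣ ≡ ∣ C ∩ B ∣ + q →
    q + ∣ D ─ B ∣ ≡ ∣ C ─ B ∣
  q+∣D─B∣≡∣C─B∣ C D ∣C∣≡k ∣D∣≡k ∣D∩B∣≡ = +-cancelˡ-≡ ∣ C ∩ B ∣ _ _ (begin
    ∣ C ∩ B ∣ + (q + ∣ D ─ B ∣) ≡⟨ +-assoc (∣ C ∩ B ∣) q (∣ D ─ B ∣) ⟨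
    ∣ C ∩ B ∣ + q + ∣ D ─ B ∣   ≡⟨ cong (_+ ∣ D ─ B ∣) ∣D∩B∣≡ ⟨
    ∣ D ∩ B ∣ + ∣ D ─ B ∣       ≡⟨ ∣C∩B∣+∣C─B∣≡i+q D ∣D∣≡k ⟩
    i + q                       ≡⟨ ∣C∩B∣+∣C─B∣≡i+q C ∣C∣≡k ⟨
    ∣ C ∩ B ∣ + ∣ C ─ B ∣       ∎)
    where open ≡-Reasoning

  walk-towards : ∀ n C → ∣ C ∣ ≡ k → k ≤ ∣ C ∩ B ∣ + Δ →
    n * q ≤ ∣ C ─ B ∣ → ∣ C ─ B ∣ ≤ (2 + n) * q → Walk v k i C B (2 + n)
  walk-towards zero C ∣C∣≡k k≤y+Δ _ r≤2q = walk₂-towards C ∣C∣≡k r≤2q k≤y+Δ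
  walk-towards (suc n) C ∣C∣≡k k≤y+Δ q+nq≤r r≤q+[2+n]q
    with step-towards C ∣C∣≡k (m+n≤o⇒m≤o q q+nq≤r)
  ... | D , ∣D∣≡k , C~D , ∣D∩B∣≡ = step ∣D∣≡k C~D (walk-towards n D ∣D∣≡k k≤y'+Δ nq≤r' r'≤[2+n]q)
    where
    q+r'≡r = q+∣D─B∣≡∣C─B∣ C D ∣C∣≡k ∣D∣≡k ∣D∩B∣≡
    k≤y'+Δ : k ≤ ∣ D ∩ B ∣ + Δ
    k≤y'+Δ = ≤-trans k≤y+Δ (+-monoˡ-≤ Δ (≤-trans (m≤m+n ∣ C ∩ B ∣ q) (≤-reflexive (sym ∣D∩B∣≡))))
    nq≤r' : n * q ≤ ∣ D ─ B ∣
    nq≤r' = +-cancelˡ-≤ q _ _ (≤-trans q+nq≤r (≤-reflexive (sym q+r'≡r)))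
    r'≤[2+n]q : ∣ D ─ B ∣ ≤ (2 + n) * q
    r'≤[2+n]q = +-cancelˡ-≤ q _ _ (≤-trans (≤-reflexive q+r'≡r) r≤q+[2+n]q)

  module _ (A : Subset v) (∣A∣≡k : ∣ A ∣ ≡ k) (x<i : ∣ A ∩ B ∣ < i) where

    private
      x = ∣ A ∩ B ∣

      q<∣A─B∣ : q < ∣ A ─ B ∣
      q<∣A─B∣ = m+n≡o+p∧m<o⇒p<n (∣C∩B∣+∣C─B∣≡i+q A ∣A∣≡k) x<i

    dist-three : x + Δ < k → Dist v k i A B 3
    dist-three x+Δ<k with step-towards A ∣A∣≡k (<⇒≤ q<∣A─B∣)
    ... | D , ∣D∣≡k , A~D , ∣D∩B∣≡x+q =
      step ∣D∣≡k A~D (walk₂-towards D ∣D∣≡k r'≤2q k≤y'+Δ) , no-shorter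
      where
      2i≤Δ : 2 * i ≤ Δ
      2i≤Δ = m≤n+m (2 * i) (v ∸ 2 * k)
      i<q : i < q
      i<q = +-cancelˡ-< i i q (begin-strict
        i + i   ≡⟨ m+m≡2*m i ⟩
        2 * i   ≤⟨ ≤-trans 2i≤Δ (m≤n+m Δ x) ⟩
        x + Δ   <⟨ x+Δ<k ⟩
        k       ≡⟨ i+q≡k ⟨
        i + q   ∎)
        where open ≤-Reasoning
      q≤y' : q ≤ ∣ D ∩ B ∣
      q≤y' = ≤-trans (m≤n+m q x) (≤-reflexive (sym ∣D∩B∣≡x+q))
      r'≤i : ∣ D ─ B ∣ ≤ i
      r'≤i = m+n≡o+p∧m≤o⇒p≤n (trans (+-comm q i) (sym (∣C∩B∣+∣C─B∣≡i+q D ∣D∣≡k))) q≤y'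
      r'≤2q : ∣ D ─ B ∣ ≤ 2 * q
      r'≤2q = ≤-trans r'≤i (≤-trans (<⇒≤ i<q) (m≤m+n q (q + 0)))
      k≤y'+Δ : k ≤ ∣ D ∩ B ∣ + Δ
      k≤y'+Δ = begin
        k             ≡⟨ trans (sym i+q≡k) (+-comm i q) ⟩
        q + i         ≤⟨ +-mono-≤ q≤y' (≤-trans (m≤m+n i (i + 0)) 2i≤Δ) ⟩
        ∣ D ∩ B ∣ + Δ ∎
        where open ≤-Reasoning
      no-shorter : ∀ m → m < 3 → ¬ Walk v k i A B m
      no-shorter 0 _ A⇝B = <⇒≱ (<-trans x<i i<k)
        (≤-trans (walk-length-bound ∣B∣≡k A⇝B) (≤-reflexive (+-identityʳ x)))
      no-shorter 1 _ (step _ A~B here) = <-irrefl A~B x<i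
      no-shorter 2 _ A⇝B = <⇒≱ x+Δ<k (≤-trans (walk₂-bound A⇝B) (≤-reflexive (begin
        ∣ ∁ (A ∪ B) ∣ + 2 * i   ≡⟨ cong (_+ 2 * i) (∣∁[C∪B]∣≡v∸2k+∣C∩B∣ A ∣A∣≡k) ⟩
        v ∸ 2 * k + x + 2 * i   ≡⟨ rearrange (v ∸ 2 * k) x (2 * i) ⟩
        x + Δ                   ∎)))
        where
        open ≡-Reasoning
        rearrange : ∀ w x j → w + x + j ≡ x + (w + j)
        rearrange = solve-∀
      no-shorter (suc (suc (suc _))) (s≤s (s≤s (s≤s ()))) _

    dist-ceil : k ≤ x + Δ → Dist v k i A B (ceilDiv (k ∸ x) q)
    dist-ceil k≤x+Δ = subst (λ r → Dist v k i A B (ceilDiv r q)) r≡k∸x (walk , no-shorter)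
      where
      r = ∣ A ─ B ∣
      r≡k∸x : r ≡ k ∸ x
      r≡k∸x = trans (sym (m+n∸m≡n x r)) (cong (_∸ x) (trans (∣C∩B∣+∣C─B∣≡i+q A ∣A∣≡k) i+q≡k))
      1<d : 1 < ceilDiv r q
      1<d = m*b<a⇒m<ceilDiv 0<q (subst (_< r) (sym (*-identityˡ q)) q<∣A─B∣)
      walk : Walk v k i A B (ceilDiv r q)
      walk with m≤n⇒∃[o]m+o≡n 1<d
      ... | n , 2+n≡d = subst (Walk v k i A B) 2+n≡d (walk-towards n A ∣A∣≡k k≤x+Δ nq≤r r≤[2+n]q)
        where
        nq≤r : n * q ≤ r
        nq≤r = <⇒≤ (m<ceilDiv⇒m*b<a 0<q (subst (n <_) 2+n≡d (n≤1+n (suc n))))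
        r≤[2+n]q : r ≤ (2 + n) * q
        r≤[2+n]q = subst (λ d → r ≤ d * q) (sym 2+n≡d) (a≤ceilDiv*b r 0<q)
      no-shorter : ∀ m → m < ceilDiv r q → ¬ Walk v k i A B m
      no-shorter m m<d A⇝B = <⇒≱ m<d (ceilDiv-least m 0<q (+-cancelˡ-≤ x r (m * q) (begin
        x + r       ≡⟨ ∣C∩B∣+∣C─B∣≡i+q A ∣A∣≡k ⟩
        i + q       ≡⟨ i+q≡k ⟩
        k           ≤⟨ walk-length-bound ∣B∣≡k A⇝B ⟩
        x + m * q   ∎)))
        where open ≤-Reasoning

lemma3p1 : (v k i : ℕ) → i < k → k < v → v ≥ 2 * k →
    ¬ (v ≡ 2 * k × i ≡ 0) →
    (A B : Subset v) → ∣ A ∣ ≡ k → ∣ B ∣ ≡ k →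
    ∣ A ∩ B ∣ < i →
    (∣ A ∩ B ∣ + (v ∸ 2 * k + 2 * i) < k → Dist v k i A B 3) ×
    (k ≤ ∣ A ∩ B ∣ + (v ∸ 2 * k + 2 * i) →
      Dist v k i A B (ceilDiv (k ∸ ∣ A ∩ B ∣) (k ∸ i)))
-- k < v follows from v ≥ 2k > k, and for (v, k, i) = (2k, k, 0) no pair has |A ∩ B| < i.
lemma3p1 v k i i<k _ 2k≤v _ A B ∣A∣≡k ∣B∣≡k x<i = dist-three A ∣A∣≡k x<i , dist-ceil A ∣A∣≡k x<i
  where open Towards i<k 2k≤v B ∣B∣≡k
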